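{- Let $b\ge2$ and $k\ge1$ be integers. The base-$b$ expansion of $Z_b(b^k)$ has exactly $k$ digits, i.e. $\lfloor\log_b Z_b(b^k)\rfloor+1=k$.
   Context: $Z_b(m)$ is the number of trailing zeroes in the base-$b$ expansion of $m!$, i.e. the largest $e\ge0$ with $b^e\mid m!$. -}

module Defs where

open import Data.Nat using (ℕ; _^_; _≤_; _<_; _!; _∸_)
open import Data.Nat.Divisibility using (_∣_)
open import Data.Product using (_×_)

IsTrailingZeros : ℕ → ℕ → ℕ → Set
IsTrailingZeros b m e = (b ^ e ∣ m !) × (∀ f → b ^ f ∣ m ! → f ≤ e)

HasDigits : ℕ → ℕ → ℕ → Set
HasDigits b n k = (b ^ (k ∸ 1) ≤ n) × (n < b ^ k)

-- Write N = b^k and let e = Z_b(N) be the exponent of the largest power of b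
-- dividing N!.  We show b^(k-1) ≤ e < b^k.
--
-- Lower bound: the factors b, 2b, …, m·b of (m·b)! show b^m ∣ (m·b)!;
-- taking m = b^(k-1) gives b^(b^(k-1)) ∣ N!, so maximality of e gives
-- b^(k-1) ≤ e.
--
-- Upper bound: pick a prime p ∣ b.  Then p^e ∣ b^e ∣ N!, and for every
-- prime p the p-adic valuation of n! is at most n - 1.  The latter is proved
-- by strong induction on n from the decomposition n! = p^q · q! · R with
-- q = ⌊n/p⌋ and p ∤ R (the multiples of p up to n contribute p^q · q!), using
-- q + (q - 1) ≤ n - 1.  Hence e ≤ N - 1 < N.
module Submission where

open import Defs
open import Data.Nat.Base
open import Data.Nat.Properties
open import Data.Nat.Divisibility
open import Data.Nat.Induction using (<-wellFounded)
open import Data.Nat.Primality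
open import Data.Nat.Primality.Factorisation using (factorise)
open import Data.Nat.ListAction using (product)
open import Data.List.Base using ([]; _∷_)
open import Data.List.Relation.Unary.All using (_∷_)
open import Data.Product using (∃-syntax; _×_; _,_)
open import Data.Sum using (inj₁; inj₂; [_,_]′)
open import Data.Empty using (⊥-elim)
open import Induction.WellFounded using (Acc; acc)
open import Relation.Nullary using (¬_; yes; no)
open import Relation.Binary.PropositionalEquality
open import Data.Nat.Solver using (module +-*-Solver)
open +-*-Solver using (solve; _:=_; _:*_)

^-pres-∣ : ∀ {a b} e → a ∣ b → a ^ e ∣ b ^ e
^-pres-∣ zero    _   = ∣-refl
^-pres-∣ (suc e) a∣b = *-pres-∣ a∣b (^-pres-∣ e a∣b)

^-cancelˡ-∣ : ∀ p .{{_ : NonZero p}} a q {X} → p ^ a ∣ p ^ q * X → p ^ (a ∸ q) ∣ X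
^-cancelˡ-∣ p a       zero    {X} d = subst (p ^ a ∣_) (*-identityˡ X) d
^-cancelˡ-∣ p zero    (suc q) {X} _ = 1∣ X
^-cancelˡ-∣ p (suc a) (suc q) {X} d =
  ^-cancelˡ-∣ p a q (*-cancelˡ-∣ p (subst (p * p ^ a ∣_) (*-assoc p (p ^ q) X) d))

-- The multiples b, 2b, …, m·b of b are among the factors of (m·b)!, so
-- b^m ∣ (m·b)!  (here b = suc c, which makes the last factor definitional).
^∣[*]! : ∀ c m → suc c ^ m ∣ (m * suc c) !
^∣[*]! c zero    = ∣-refl
^∣[*]! c (suc m) =
  *-pres-∣ (n∣m*n (suc m) {suc c}) (∣-trans (^∣[*]! c m) (m≤n⇒m!∣n! (m≤n+m (m * suc c) c)))

primeDivisor : ∀ n → 2 ≤ n → ∃[ p ] Prime p × p ∣ n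
primeDivisor (suc zero) (s≤s ())
primeDivisor n@(suc (suc _)) _ with factorise n
... | record { factors = [] ; isFactorisation = () }
... | record { factors = p ∷ ps ; isFactorisation = n≡∏ ; factorsPrime = p-prime ∷ _ } =
  p , p-prime , subst (p ∣_) (sym n≡∏) (m∣m*n (product ps))

+-pred-≤ : ∀ q n → q + q ≤ n → q + pred q ≤ pred n
+-pred-≤ zero    n       _          = z≤n
+-pred-≤ (suc q) (suc n) (s≤s q+q≤n) = subst (_≤ n) (+-suc q q) q+q≤n

sandwiched-multiple : ∀ {p q c} .{{_ : NonZero p}} →
  q * p < c * p → c * p ≤ suc q * p → c ≡ suc q
sandwiched-multiple {p} {q} {c} lo hi =
  ≤-antisym (*-cancelʳ-≤ c (suc q) p hi) (*-cancelʳ-< _ q c lo)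

module PrimeInFactorial {p : ℕ} (p-prime : Prime p) where

  private instance
    p≢0 : NonZero p
    p≢0 = prime⇒nonZero p-prime

  p∤1 : ¬ p ∣ 1
  p∤1 p∣1 = nonTrivial⇒≢1 {{prime⇒nonTrivial p-prime}} (∣1⇒≡1 p∣1)

  cancel-coprime : ∀ a X R → ¬ p ∣ R → p ^ a ∣ X * R → p ^ a ∣ X
  cancel-coprime zero    X R _   _ = 1∣ X
  cancel-coprime (suc a) X R p∤R d with euclidsLemma X R p-prime (m*n∣⇒m∣ p (p ^ a) d)
  ... | inj₂ p∣R = ⊥-elim (p∤R p∣R)
  ... | inj₁ (divides x refl) = subst (p * p ^ a ∣_) (*-comm p x) (*-monoʳ-∣ p p^a∣x)
    where
    regroup : x * p * R ≡ p * (x * R)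
    regroup = solve 3 (λ x r p → (x :* p) :* r := p :* (x :* r)) refl x R p
    p^a∣x : p ^ a ∣ x
    p^a∣x = cancel-coprime a x R p∤R (*-cancelˡ-∣ p (subst (p * p ^ a ∣_) regroup d))

  -- n! = p^q · q! · R with p ∤ R, where q = ⌊n/p⌋ is pinned down by
  -- q·p ≤ n < (q+1)·p.
  record Decomposition (n : ℕ) : Set where
    field
      q R       : ℕ
      factorial : n ! ≡ p ^ q * q ! * R
      p∤R       : ¬ p ∣ R
      lower     : q * p ≤ n
      upper     : n < suc q * p

  -- Every n! decomposes.  Passing from n to n+1, the quotient q grows
  -- exactly when p ∣ n+1, in which case n+1 = (q+1)·p feeds p^(q+1)·(q+1)!;
  -- otherwise n+1 is absorbed into the coprime part.
  decompose : ∀ n → Decomposition n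
  decompose zero = record
    { q = 0 ; R = 1 ; factorial = refl ; p∤R = p∤1 ; lower = z≤n ; upper = ≤-trans (>-nonZero⁻¹ p) (m≤m+n p 0) }
  decompose (suc n) with decompose n | p ∣? suc n
  ... | record { q = q ; R = R ; factorial = eq ; p∤R = p∤R ; lower = lo ; upper = hi } | no p∤n+1
    = record
    { q = q ; R = suc n * R
    ; factorial = trans (cong (suc n *_) eq)
        (solve 4 (λ m a b r → m :* (a :* b :* r) := a :* b :* (m :* r)) refl (suc n) (p ^ q) (q !) R)
    ; p∤R = λ p∣n+1*R → [ p∤n+1 , p∤R ]′ (euclidsLemma (suc n) R p-prime p∣n+1*R)
    ; lower = m≤n⇒m≤1+n lo
    ; upper = ≤∧≢⇒< hi (λ n+1≡ → p∤n+1 (divides (suc q) n+1≡))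
    }
  ... | record { q = q ; R = R ; factorial = eq ; p∤R = p∤R ; lower = lo ; upper = hi } | yes (divides c n+1≡c*p)
    = record
    { q = suc q ; R = R
    ; factorial = step
    ; p∤R = p∤R
    ; lower = ≤-reflexive (sym n+1≡q+1*p)
    ; upper = subst (_< suc (suc q) * p) (sym n+1≡q+1*p) (m<n+m (suc q * p) (>-nonZero⁻¹ p))
    }
    where
    n+1≡q+1*p : suc n ≡ suc q * p
    n+1≡q+1*p = trans n+1≡c*p (cong (_* p) (sandwiched-multiple {p} {q} {c}
      (subst (q * p <_) n+1≡c*p (s≤s lo)) (subst (_≤ suc q * p) n+1≡c*p hi)))
    step : suc n ! ≡ p ^ suc q * suc q ! * R
    step = begin
      suc n * n !                    ≡⟨ cong₂ _*_ n+1≡q+1*p eq ⟩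
      suc q * p * (p ^ q * q ! * R)  ≡⟨ solve 5 (λ s p a f r → s :* p :* (a :* f :* r) := p :* a :* (s :* f) :* r)
                                               refl (suc q) p (p ^ q) (q !) R ⟩
      p * p ^ q * (suc q * q !) * R  ∎
      where open ≡-Reasoning

  quotient-double : ∀ {n} (D : Decomposition n) → Decomposition.q D + Decomposition.q D ≤ n
  quotient-double {n} D = begin
    q + q      ≡⟨ cong (q +_) (sym (+-identityʳ q)) ⟩
    2 * q      ≡⟨ *-comm 2 q ⟩
    q * 2      ≤⟨ *-monoʳ-≤ q (nonTrivial⇒n>1 p {{prime⇒nonTrivial p-prime}}) ⟩
    q * p      ≤⟨ lower ⟩
    n          ∎
    where open Decomposition D
          open ≤-Reasoning

  -- The p-adic valuation of n! is at most n - 1: by strong induction,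
  -- p^a ∣ p^q · q! gives a ≤ q + v_p(q!) ≤ q + (q - 1) ≤ n - 1.
  valuation-bound : ∀ n a → p ^ a ∣ n ! → a ≤ pred n
  valuation-bound n = go n (<-wellFounded n)
    where
    go : ∀ n → Acc _<_ n → ∀ a → p ^ a ∣ n ! → a ≤ pred n
    go zero    _         zero    _ = z≤n
    go zero    _         (suc a) d = ⊥-elim (p∤1 (m*n∣⇒m∣ p (p ^ a) d))
    go (suc m) (acc rec) a       d = begin
      a              ≤⟨ m≤n+m∸n a q ⟩
      q + (a ∸ q)    ≤⟨ +-monoʳ-≤ q (go q (rec (s≤s q≤m)) (a ∸ q) p^[a-q]∣q!) ⟩
      q + pred q     ≤⟨ q+pred-q≤m ⟩
      m              ∎
      where
      D = decompose (suc m)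
      open Decomposition D
      open ≤-Reasoning
      q+pred-q≤m : q + pred q ≤ m
      q+pred-q≤m = +-pred-≤ q (suc m) (quotient-double D)
      q≤m : q ≤ m
      q≤m = ≤-trans (m≤m+n q (pred q)) q+pred-q≤m
      p^[a-q]∣q! : p ^ (a ∸ q) ∣ q !
      p^[a-q]∣q! = ^-cancelˡ-∣ p a q (cancel-coprime a (p ^ q * q !) R p∤R (subst (p ^ a ∣_) factorial d))

proposition6 : (b k : ℕ) → 2 ≤ b → 1 ≤ k →
    ∀ e → IsTrailingZeros b (b ^ k) e → HasDigits b e k
proposition6 b@(suc c) (suc k) 2≤b _ e (b^e∣N! , maximal) = lower , upper
  where
  N = b ^ suc k
  instance
    N≢0 : NonZero N
    N≢0 = m^n≢0 b (suc k)

  lower : b ^ k ≤ e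
  lower = maximal (b ^ k) (subst (λ x → b ^ (b ^ k) ∣ x !) (*-comm (b ^ k) b) (^∣[*]! c (b ^ k)))

  upper : e < N
  upper with primeDivisor b 2≤b
  ... | p , p-prime , p∣b =
    subst (e <_) (suc-pred N) (s≤s (PrimeInFactorial.valuation-bound p-prime N e p^e∣N!))
    where
    p^e∣N! : p ^ e ∣ N !
    p^e∣N! = ∣-trans (^-pres-∣ e p∣b) b^e∣N!
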